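{- Let $\sigma$ be a consistent permutation, $\varphi$ a modal CNF formula, and $\mathcal{M}=\langle w,W,V,R\rangle$, $\mathcal{M}'=\langle w',W',V',R'\rangle$ models such that $\mathcal{M}$ and $\mathcal{M}'$ are $\sigma$-similar. Then $\mathcal{M}\models\varphi$ if and only if $\mathcal{M}'\models\sigma(\varphi)$.
   Context: Fix a modal signature $\langle \mathsf{Atom}, \mathsf{Mod}\rangle$ of two countable disjoint sets. A literal is $a$ or $\neg a$ with $a\in\mathsf{Atom}$; $\mathsf{ALit}$ is the set of literals, $\neg\neg a=a$. A modal CNF formula is a finite set of modal CNF clauses (read conjunctively); a modal CNF clause is a finite set (read disjunctively) of literals and modal literals; a modal literal is $[m]C$ or $\neg[m]C$, $m\in\mathsf{Mod}$, $C$ a modal CNF clause. Some modalities may be indexed by an atom $a$ (written $m(a)$). Models (coinductive): for nonempty $W$, $\mathbf{Mods}_W$ is the coinductively defined class of tuples $\langle w,W,V,R\rangle$ with $w\in W$, $V(v)\subseteq\mathsf{Atom}$, $R(m,v)\subseteq\mathbf{Mods}_W$ for $m\in\mathsf{Mod}$, $v\in W$. $\mathrm{Ext}(\mathcal{M})$ is the smallest subset of $\mathbf{Mods}_W$ containing $\mathcal{M}$ such that $\mathcal{N}\in\mathrm{Ext}(\mathcal{M})$ implies $R^{\mathcal{N}}(m,v)\subseteq\mathrm{Ext}(\mathcal{M})$. Satisfaction: $\mathcal{M}\models\varphi$ iff $\mathcal{M}\models C$ for all $C\in\varphi$; $\mathcal{M}\models C$ iff some $\lambda\in C$ has $\mathcal{M}\models\lambda$;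 $\mathcal{M}\models a$ iff $a\in V(w)$; $\mathcal{M}\models\neg a$ iff $a\notin V(w)$; $\mathcal{M}\models[m]C$ iff $\mathcal{N}\models C$ for all $\mathcal{N}\in R(m,w)$; $\mathcal{M}\models\neg[m]C$ iff $\mathcal{M}\not\models[m]C$. Permutations: bijections $\sigma:\mathsf{ALit}\to\mathsf{ALit}$ moving only finitely many literals; consistent if $\sigma(\neg l)=\neg\sigma(l)$ for all $l$. For a modality, $\sigma(m(a))=m(\sigma(a))$ if $m$ is indexed by atom $a$, else $\sigma(m)=m$. On formulas: $\sigma(\varphi)=\{\sigma(C):C\in\varphi\}$, $\sigma(C)=\{\sigma(\lambda):\lambda\in C\}$, $\sigma([m]C)=[\sigma(m)]\sigma(C)$, $\sigma(\neg[m]C)=\neg[\sigma(m)]\sigma(C)$. For $S\subseteq\mathsf{Atom}$, $L_S=S\cup\{\neg a:a\in\mathsf{Atom}\setminus S\}$. $\sigma$-simulation: a non-empty relation $Z\subseteq\mathrm{Ext}(\mathcal{M})\times\mathrm{Ext}(\mathcal{M}')$ such that (Root) $\mathcal{M}Z\mathcal{M}'$; and whenever $\mathcal{N}=\langle v,W,U,S\rangle$ and $\mathcal{N}'=\langle v',W',U',S'\rangle$ satisfy $\mathcal{N}Z\mathcal{N}'$: (Harmony) for every literal $l$, $l\in L_{U(v)}$ iff $\sigma(l)\in L_{U'(v')}$; (Zig) for every $\mathcal{K}\in S(m,v)$ there is $\mathcal{K}'\in S'(\sigma(m),v')$ with $\mathcal{K}Z\mathcal{K}'$; (Zag) for every $\mathcal{K}'\in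 S'(m,v')$ there is $\mathcal{K}\in S(\sigma^{ -1}(m),v)$ with $\mathcal{K}Z\mathcal{K}'$. $\mathcal{M}$ and $\mathcal{M}'$ are $\sigma$-similar if there is a $\sigma$-simulation between them. -}

module Defs where

open import Data.Empty using (⊥)
open import Data.Unit using (⊤)
open import Data.Sum using (_⊎_)
open import Data.Bool using (Bool; true; false; not)
open import Data.Product using (Σ; ∃; _×_; _,_)
open import Data.List using (List; []; _∷_)
open import Data.List.Membership.Propositional using (_∈_)
open import Data.List.Relation.Unary.Any using (Any)
open import Relation.Nullary using (¬_)
open import Relation.Binary.PropositionalEquality using (_≡_)
open import Function.Bundles using (_↔_; Inverse; _⇔_)
open import Level using (Level; suc; zero)

-- The signature: Atom is the set of atoms; modalities are either plain
-- (from PM) or indexed by an atom (m(a), with m from IM).  Mod is thus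
-- automatically disjoint from Atom.
module Syntax (Atom PM IM : Set) where

  data Mod : Set where
    plain : PM → Mod
    idx   : IM → Atom → Mod

  -- literals: (a , true) is a, (a , false) is ¬ a
  ALit : Set
  ALit = Atom × Bool

  pos : Atom → ALit
  pos a = a , true

  neg : ALit → ALit
  neg (a , b) = a , not b

  atomOf : ALit → Atom
  atomOf (a , _) = a

  -- modal CNF: clauses are finite sets (lists) of items; formulas finite sets of clauses
  data Item : Set where
    lit  : ALit → Item
    box  : Mod → List Item → Item
    nbox : Mod → List Item → Item

  Clause : Set
  Clause = List Item

  Formula : Set
  Formula = List Clause

  record ConsistentPerm : Set where
    field
      perm       : ALit ↔ ALit
      finSupport : ∃ λ (L : List ALit) → ∀ l → ¬ (l ∈ L) → Inverse.to perm l ≡ l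
      consistent : ∀ l → Inverse.to perm (neg l) ≡ neg (Inverse.to perm l)

    app : ALit → ALit
    app = Inverse.to perm

    app⁻¹ : ALit → ALit
    app⁻¹ = Inverse.from perm

    -- σ(m(a)) = m(σ(a)), where σ(a) is read as the atom of the literal σ(a)
    appMod : Mod → Mod
    appMod (plain m) = plain m
    appMod (idx m a) = idx m (atomOf (app (pos a)))

    appMod⁻¹ : Mod → Mod
    appMod⁻¹ (plain m) = plain m
    appMod⁻¹ (idx m a) = idx m (atomOf (app⁻¹ (pos a)))

    mutual
      appItem : Item → Item
      appItem (lit l)    = lit (app l)
      appItem (box m C)  = box (appMod m) (appClause C)
      appItem (nbox m C) = nbox (appMod m) (appClause C)

      appClause : Clause → Clause
      appClause []      = []
      appClause (x ∷ C) = appItem x ∷ appClause C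

    appFormula : Formula → Formula
    appFormula []      = []
    appFormula (C ∷ φ) = appClause C ∷ appFormula φ

  -- Models over a nonempty world set W (coinductive).  R(m,v) ⊆ Mods_W is
  -- represented as a family of models indexed by  succ m v .
  record Model (W : Set) : Set₁ where
    coinductive
    field
      world : W
      val   : W → Atom → Set
      succ  : Mod → W → Set
      next  : (m : Mod) (v : W) → succ m v → Model W
  open Model public

  inL : (Atom → Set) → ALit → Set
  inL S (a , true)  = S a
  inL S (a , false) = ¬ S a

  mutual
    _⊨I_ : ∀ {W} → Model W → Item → Set
    M ⊨I lit l    = inL (val M (world M)) l
    M ⊨I box m C  = ∀ (i : succ M m (world M)) → next M m (world M) i ⊨C C
    M ⊨I nbox m C = ¬ (∀ (i : succ M m (world M)) → next M m (world M) i ⊨C C)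

    _⊨C_ : ∀ {W} → Model W → Clause → Set
    M ⊨C []      = ⊥
    M ⊨C (x ∷ C) = (M ⊨I x) ⊎ (M ⊨C C)

  _⊨_ : ∀ {W} → Model W → Formula → Set
  M ⊨ []      = ⊤
  M ⊨ (C ∷ φ) = (M ⊨C C) × (M ⊨ φ)

  data Ext {W : Set} (M : Model W) : Model W → Set₁ where
    root : Ext M M
    step : ∀ {N} → Ext M N → (m : Mod) (v : W) (i : succ N m v) → Ext M (next N m v i)

  record IsSimulation (σ : ConsistentPerm) {W W' : Set}
           (M : Model W) (M' : Model W') (Z : Model W → Model W' → Set₁) : Set₁ where
    open ConsistentPerm σ
    field
      inExt   : ∀ {N N'} → Z N N' → Ext M N × Ext M' N'
      rootZ   : Z M M'
      harmony : ∀ {N N'} → Z N N' → ∀ (l : ALit) →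
                  inL (val N (world N)) l ⇔ inL (val N' (world N')) (app l)
      zig     : ∀ {N N'} → Z N N' → ∀ (m : Mod) (i : succ N m (world N)) →
                  Σ (succ N' (appMod m) (world N')) λ i' →
                    Z (next N m (world N) i) (next N' (appMod m) (world N') i')
      zag     : ∀ {N N'} → Z N N' → ∀ (m : Mod) (i' : succ N' m (world N')) →
                  Σ (succ N (appMod⁻¹ m) (world N)) λ i →
                    Z (next N (appMod⁻¹ m) (world N) i) (next N' m (world N') i')

  Similar : ConsistentPerm → ∀ {W W'} → Model W → Model W' → Set₂
  Similar σ M M' = Σ (Model _ → Model _ → Set₁) λ Z → IsSimulation σ M M' Z

-- Truth of modal CNF is preserved along a σ-simulation by induction on the
-- formula: literals are handled by Harmony, a box [m]C at N by Zig (to go from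
-- N' ⊨ [σ m] σ C back to N) and by Zag (for the converse), the latter landing
-- in R(σ⁻¹(σ m)) = R(m) because consistency makes σ⁻¹ undo σ on indexed
-- modalities.
module Submission where

open import Defs
open import Data.Nat using (ℕ)
open import Data.Bool using (true; false)
open import Data.Unit using (tt)
open import Data.List using ([]; _∷_)
open import Data.Product using (_,_)
open import Data.Sum.Function.Propositional using (_⊎-⇔_)
open import Data.Product.Function.NonDependent.Propositional using (_×-⇔_)
open import Function.Bundles using (_↣_; _⇔_; mk⇔; Equivalence; Inverse)
open import Function.Related.TypeIsomorphisms using (¬-cong-⇔)
open import Relation.Binary.PropositionalEquality using (_≡_; refl; sym; trans; cong; subst)

module _ {Atom PM IM : Set} where
  open Syntax Atom PM IM

  module _ (σ : ConsistentPerm) where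
    open ConsistentPerm σ

    -- σ(a) may be a negative literal ¬b; consistency then gives σ(¬a) = b.
    atomOf-app⁻¹-pos-atomOf-app : ∀ a → atomOf (app⁻¹ (pos (atomOf (app (pos a))))) ≡ a
    atomOf-app⁻¹-pos-atomOf-app a with app (pos a) in σa
    ... | b , true  = cong atomOf (trans (cong app⁻¹ (sym σa)) (Inverse.strictlyInverseʳ perm (pos a)))
    ... | b , false = cong atomOf (trans (cong app⁻¹ σ¬a) (Inverse.strictlyInverseʳ perm (a , false)))
      where
      σ¬a : (b , true) ≡ app (a , false)
      σ¬a = sym (trans (consistent (pos a)) (cong neg σa))

    appMod⁻¹-appMod : ∀ m → appMod⁻¹ (appMod m) ≡ m
    appMod⁻¹-appMod (plain m) = refl
    appMod⁻¹-appMod (idx m a) = cong (idx m) (atomOf-app⁻¹-pos-atomOf-app a)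

    module _ {W W' : Set} {M : Model W} {M' : Model W'}
             {Z : Model W → Model W' → Set₁} (S : IsSimulation σ M M' Z) where
      open IsSimulation S

      mutual
        ⊨I-preserved : ∀ {N N'} → Z N N' → (x : Item) → (N ⊨I x) ⇔ (N' ⊨I appItem x)
        ⊨I-preserved z (lit l)    = harmony z l
        ⊨I-preserved z (box m C)  = ⊨-box-preserved z m C
        ⊨I-preserved z (nbox m C) = ¬-cong-⇔ (⊨-box-preserved z m C)

        ⊨-box-preserved : ∀ {N N'} → Z N N' → (m : Mod) (C : Clause) →
          (N ⊨I box m C) ⇔ (N' ⊨I box (appMod m) (appClause C))
        ⊨-box-preserved {N} {N'} z m C = mk⇔ forth back
          where
          forth : N ⊨I box m C → N' ⊨I box (appMod m) (appClause C)
          forth N⊨□C i' with zag z (appMod m) i'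
          ... | i , z′ = Equivalence.to (⊨C-preserved z′ C) (N⊨□σ⁻¹σC i)
            where
            N⊨□σ⁻¹σC : N ⊨I box (appMod⁻¹ (appMod m)) C
            N⊨□σ⁻¹σC = subst (λ m₀ → N ⊨I box m₀ C) (sym (appMod⁻¹-appMod m)) N⊨□C

          back : N' ⊨I box (appMod m) (appClause C) → N ⊨I box m C
          back N'⊨□σC i with zig z m i
          ... | i' , z′ = Equivalence.from (⊨C-preserved z′ C) (N'⊨□σC i')

        ⊨C-preserved : ∀ {N N'} → Z N N' → (C : Clause) → (N ⊨C C) ⇔ (N' ⊨C appClause C)
        ⊨C-preserved z []      = mk⇔ (λ ()) (λ ())
        ⊨C-preserved z (x ∷ C) = ⊨I-preserved z x ⊎-⇔ ⊨C-preserved z C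

      ⊨-preserved : ∀ {N N'} → Z N N' → (φ : Formula) → (N ⊨ φ) ⇔ (N' ⊨ appFormula φ)
      ⊨-preserved z []      = mk⇔ (λ _ → tt) (λ _ → tt)
      ⊨-preserved z (C ∷ φ) = ⊨C-preserved z C ×-⇔ ⊨-preserved z φ

proposition1 : (Atom PM IM : Set) → Atom ↣ ℕ → PM ↣ ℕ → IM ↣ ℕ →
    let open Syntax Atom PM IM in
    (σ : ConsistentPerm) (φ : Formula) {W W' : Set} (M : Model W) (M' : Model W') →
    Similar σ M M' →
    (M ⊨ φ) ⇔ (M' ⊨ ConsistentPerm.appFormula σ φ)
proposition1 Atom PM IM _ _ _ σ φ M M' (Z , S) =
  ⊨-preserved σ S (Syntax.IsSimulation.rootZ S) φ
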